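{- Let $p$ be a prime and $m\in\mathbb{F}_p\setminus\{ -1\}$. If $p = 7$, the fundamental block $F(p,m)$ contains at least three zero entries; if $p\ge 11$, $F(p,m)$ contains at least four zero entries.
   Context: $F(p,m) = (a_{i,j})_{0\le i,j\le p-1}$ is the $p\times p$ matrix over $\mathbb{F}_p$ with $a_{i,0} = a_{0,j}=1$ and $a_{i,j} = a_{i-1,j} + m\,a_{i-1,j-1} + a_{i,j-1}$ for $i,j\ge1$. -}

module Defs where

open import Data.Nat using (ℕ; zero; suc; _+_; _*_; NonZero)
open import Data.Nat.DivMod using (_%_)
open import Data.Nat.Properties using (_≟_)
open import Data.List using (List; map; upTo)
open import Data.Nat.ListAction using (sum)
open import Relation.Nullary.Decidable using (does)
open import Data.Bool using (if_then_else_)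

-- Entry a_{i,j} of F(p,m), with F_p represented by residues {0,…,p-1}
-- (all arithmetic reduced mod p).  Defined for all i j; only 0 ≤ i,j ≤ p-1
-- are used (the fundamental block).
entry : (p : ℕ) .{{_ : NonZero p}} → ℕ → ℕ → ℕ → ℕ
entry p m zero    j       = 1 % p
entry p m (suc i) zero    = 1 % p
entry p m (suc i) (suc j) =
  (entry p m i (suc j) + m * entry p m i j + entry p m (suc i) j) % p

zeroCount : (p : ℕ) .{{_ : NonZero p}} → ℕ → ℕ
zeroCount p m =
  sum (map (λ i → sum (map (λ j →
         if does (entry p m i j ≟ 0) then 1 else 0) (upTo p))) (upTo p))

-- Over ℤ, F(i, j) = Σₖ C(i,k) C(j,k) cᵏ with c = 1 + m, since the right-hand side satisfies the
-- same recurrence (apply Pascal's rule to both binomials).  Modulo a prime p = q + 2 we have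
-- C(q, k) ≡ (-1)ᵏ (k + 1), so the binomial theorem gives F(q, j + 1) ≡ (1 - c)ʲ (1 - (j + 2) c),
-- while F(1, j) = 1 + j c.  As c ≢ 0, the residue j₀ ≡ -1/c lies in [1, p - 1]; F vanishes at
-- (1, j₀) and, for j₀ ≠ p - 1, at (q, p - 1 - j₀), hence by symmetry also at the mirror images.
-- These are four distinct zeros unless j₀ ∈ {1, p - 2, p - 1}, i.e. c ≡ -1, 1/2, 1; then the zeros
-- at (3, 3) and (5, 5), at (3, p - 4) and its mirror image, resp. at (q, 2) and its mirror image
-- (where the factor 1 - c vanishes) take over.  Only for p = 7 do two of them collide
-- ((5, 5) = (q, q), resp. (3, p - 4) = (3, 3)), which leaves three zeros.

module Submission where

open import Data.Bool using (if_then_else_)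
open import Data.Integer using (ℤ; +_; -_; _+_; _*_; _-_; _^_; 0ℤ; 1ℤ; -1ℤ; ∣_∣)
open import Data.Integer.Divisibility.Signed using (_∣_; divides; ∣m∣n⇒∣m+n; ∣m⇒∣-m; ∣n⇒∣m*n; ∣⇒∣ᵤ; ∣ᵤ⇒∣)
open import Data.Integer.DivMod using (_%ℕ_; _/ℕ_; a≡a%ℕn+[a/ℕn]*n; n%ℕd<d)
import Data.Integer.Properties as ℤ
open import Data.Integer.Tactic.RingSolver using (solve-∀)
open import Data.List using (List; []; _∷_; map; upTo; applyUpTo; length)
open import Data.List.Properties using (map-upTo; map-cong)
open import Data.List.Relation.Unary.All as All using (All; []; _∷_)
open import Data.List.Relation.Unary.Unique.Propositional using (Unique; []; _∷_)
open import Data.Nat as ℕ using (ℕ; zero; suc; _<_; _≤_; _≥_; _∸_; s≤s; z≤n; NonZero)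
open import Data.Nat.Combinatorics using (_C_; nCk+nC[k+1]≡[n+1]C[k+1]; k>n⇒nCk≡0; nC1≡n)
open import Data.Nat.Coprimality using (coprime-Bézout; prime⇒coprime)
open import Data.Nat.Divisibility using (n∣m⇒m%n≡0; >⇒∤)
  renaming (_∣_ to _ℕ∣_; divides to ℕdivides; ∣1⇒≡1 to ℕ∣1⇒≡1)
open import Data.Nat.DivMod using (m%n<n; m<n⇒m%n≡m)
open import Data.Nat.GCD using (module Bézout)
open import Data.Nat.ListAction using (sum)
open import Data.Nat.Primality using (Prime; prime⇒nonZero; euclidsLemma)
import Data.Nat.Properties as ℕ
import Data.Nat.Tactic.RingSolver as ℕ-Solver
open import Data.Product using (_×_; _,_; ∃-syntax; proj₁; proj₂)
open import Data.Product.Properties using (≡-dec; ,-injectiveˡ)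
open import Data.Sum using (inj₁; inj₂)
open import Function using (_∘_)
open import Level using (0ℓ)
open import Relation.Binary.Bundles using (Setoid)
open import Relation.Binary.PropositionalEquality
  using (_≡_; _≢_; refl; sym; trans; cong; cong₂; subst; module ≡-Reasoning)
import Relation.Binary.Reasoning.Setoid as ≈-Reasoning
open import Relation.Nullary using (¬_; contradiction)
open import Relation.Nullary.Decidable using (Dec; does; yes; no; dec-true; dec-false)

open import Defs

-- Finite sums and binomial coefficients

∑ : ℕ → (ℕ → ℤ) → ℤ
∑ zero    f = 0ℤ
∑ (suc n) f = ∑ n f + f n

∑-cong : ∀ n {f g : ℕ → ℤ} → (∀ k → f k ≡ g k) → ∑ n f ≡ ∑ n g
∑-cong zero    f≗g = refl
∑-cong (suc n) f≗g = cong₂ _+_ (∑-cong n f≗g) (f≗g n)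

∑-distrib-+ : ∀ n (f g : ℕ → ℤ) → ∑ n (λ k → f k + g k) ≡ ∑ n f + ∑ n g
∑-distrib-+ zero    f g = refl
∑-distrib-+ (suc n) f g rewrite ∑-distrib-+ n f g = swap (∑ n f) (∑ n g) (f n) (g n)
  where swap : ∀ a b c d → a + b + (c + d) ≡ a + c + (b + d)
        swap = solve-∀

*-distribˡ-∑ : ∀ n a (f : ℕ → ℤ) → ∑ n (λ k → a * f k) ≡ a * ∑ n f
*-distribˡ-∑ zero    a f = sym (ℤ.*-zeroʳ a)
*-distribˡ-∑ (suc n) a f rewrite *-distribˡ-∑ n a f = sym (ℤ.*-distribˡ-+ a (∑ n f) (f n))

∑-suc : ∀ n (f : ℕ → ℤ) → ∑ (suc n) f ≡ f 0 + ∑ n (f ∘ suc)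
∑-suc zero    f = ℤ.+-comm 0ℤ (f 0)
∑-suc (suc n) f rewrite ∑-suc n f = ℤ.+-assoc (f 0) _ _

∑-vanishing : ∀ n {f : ℕ → ℤ} → (∀ k → f k ≡ 0ℤ) → ∑ n f ≡ 0ℤ
∑-vanishing zero    f≗0 = refl
∑-vanishing (suc n) f≗0 = cong₂ _+_ (∑-vanishing n f≗0) (f≗0 n)

∑-vanishing-last : ∀ n (f : ℕ → ℤ) → f n ≡ 0ℤ → ∑ (suc n) f ≡ ∑ n f
∑-vanishing-last n f fn≡0 rewrite fn≡0 = ℤ.+-identityʳ (∑ n f)

C-absorb : ∀ n k → suc k ℕ.* (suc n C suc k) ≡ suc n ℕ.* (n C k)
C-absorb zero    zero    = refl
C-absorb zero    (suc k) = ℕ.*-zeroʳ (suc (suc k))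
C-absorb (suc n) zero    = trans (ℕ.+-identityʳ _) (trans (nC1≡n (suc (suc n))) (sym (ℕ.*-identityʳ _)))
C-absorb (suc n) (suc k) = begin
  suc (suc k) ℕ.* (suc (suc n) C suc (suc k))
    ≡⟨ cong (suc (suc k) ℕ.*_) (sym (nCk+nC[k+1]≡[n+1]C[k+1] (suc n) (suc k))) ⟩
  suc (suc k) ℕ.* (a ℕ.+ b)
    ≡⟨ regroup (suc k) a b ⟩
  suc k ℕ.* a ℕ.+ suc (suc k) ℕ.* b ℕ.+ a
    ≡⟨ cong₂ (λ x y → x ℕ.+ y ℕ.+ a) (C-absorb n k) (C-absorb n (suc k)) ⟩
  suc n ℕ.* (n C k) ℕ.+ suc n ℕ.* (n C suc k) ℕ.+ a
    ≡⟨ cong (ℕ._+ a) (sym (ℕ.*-distribˡ-+ (suc n) (n C k) (n C suc k))) ⟩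
  suc n ℕ.* (n C k ℕ.+ n C suc k) ℕ.+ a
    ≡⟨ cong (λ x → suc n ℕ.* x ℕ.+ a) (nCk+nC[k+1]≡[n+1]C[k+1] n k) ⟩
  suc n ℕ.* a ℕ.+ a
    ≡⟨ ℕ.+-comm (suc n ℕ.* a) a ⟩
  suc (suc n) ℕ.* a
    ∎
  where
  open ≡-Reasoning
  a = suc n C suc k
  b = suc n C suc (suc k)
  regroup : ∀ k a b → suc k ℕ.* (a ℕ.+ b) ≡ k ℕ.* a ℕ.+ suc k ℕ.* b ℕ.+ a
  regroup = ℕ-Solver.solve-∀

pascal-difference : ∀ n k → + (n C suc k) ≡ + (suc n C suc k) + -1ℤ * + (n C k)
pascal-difference n k = trans (isolate (+ (n C k)) (+ (n C suc k)))
  (cong (_+ -1ℤ * + (n C k)) (trans (sym (ℤ.pos-+ (n C k) (n C suc k))) (cong +_ (nCk+nC[k+1]≡[n+1]C[k+1] n k))))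
  where isolate : ∀ a b → b ≡ (a + b) + -1ℤ * a
        isolate = solve-∀

p∣pC[1+k] : ∀ {n k} → Prime (suc n) → k < n → suc n ℕ∣ (suc n C suc k)
p∣pC[1+k] {n} {k} p-prime k<n
  with euclidsLemma (suc k) (suc n C suc k) p-prime (ℕdivides (n C k) (trans (C-absorb n k) (ℕ.*-comm (suc n) (n C k))))
... | inj₁ p∣1+k = contradiction p∣1+k (>⇒∤ (s≤s k<n))
... | inj₂ p∣C   = p∣C

-1^k*x^k≡[-x]^k : ∀ x k → -1ℤ ^ k * x ^ k ≡ (- x) ^ k
-1^k*x^k≡[-x]^k x zero    = refl
-1^k*x^k≡[-x]^k x (suc k) = trans (regroup (-1ℤ ^ k) (x ^ k) x) (cong (- x *_) (-1^k*x^k≡[-x]^k x k))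
  where regroup : ∀ s w x → (-1ℤ * s) * (x * w) ≡ - x * (s * w)
        regroup = solve-∀

∑-binomial : ∀ x n N → n < N → ∑ N (λ k → + (n C k) * x ^ k) ≡ (1ℤ + x) ^ n
∑-binomial x zero    (suc N) _ = trans (∑-suc N _) (cong (_+_ 1ℤ) (∑-vanishing N (λ _ → refl)))
∑-binomial x (suc n) (suc N) (s≤s n<N) = begin
  ∑ (suc N) (λ k → + (suc n C k) * x ^ k)
    ≡⟨ ∑-suc N _ ⟩
  1ℤ + ∑ N (λ k → + (suc n C suc k) * x ^ suc k)
    ≡⟨ cong (_+_ 1ℤ) (∑-cong N pascal) ⟩
  1ℤ + ∑ N (λ k → x * g k + g (suc k))
    ≡⟨ cong (_+_ 1ℤ) (∑-distrib-+ N (λ k → x * g k) (g ∘ suc)) ⟩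
  1ℤ + (∑ N (λ k → x * g k) + ∑ N (g ∘ suc))
    ≡⟨ cong (λ s → 1ℤ + (s + ∑ N (g ∘ suc))) (*-distribˡ-∑ N x g) ⟩
  1ℤ + (x * ∑ N g + ∑ N (g ∘ suc))
    ≡⟨ regroup (x * ∑ N g) (∑ N (g ∘ suc)) ⟩
  x * ∑ N g + (1ℤ + ∑ N (g ∘ suc))
    ≡⟨ cong₂ (λ s t → x * s + t) (∑-binomial x n N n<N) (sym (∑-suc N g)) ⟩
  x * (1ℤ + x) ^ n + ∑ (suc N) g
    ≡⟨ cong (_+_ (x * (1ℤ + x) ^ n)) (∑-binomial x n (suc N) (ℕ.m<n⇒m<1+n n<N)) ⟩
  x * (1ℤ + x) ^ n + (1ℤ + x) ^ n
    ≡⟨ factor x ((1ℤ + x) ^ n) ⟩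
  (1ℤ + x) ^ suc n
    ∎
  where
  open ≡-Reasoning
  g : ℕ → ℤ
  g k = + (n C k) * x ^ k
  pascal : ∀ k → + (suc n C suc k) * x ^ suc k ≡ x * g k + g (suc k)
  pascal k = begin
    + (suc n C suc k) * (x * x ^ k)
      ≡⟨ cong (λ c → + c * (x * x ^ k)) (sym (nCk+nC[k+1]≡[n+1]C[k+1] n k)) ⟩
    + (n C k ℕ.+ n C suc k) * (x * x ^ k)
      ≡⟨ cong (_* (x * x ^ k)) (ℤ.pos-+ (n C k) (n C suc k)) ⟩
    (+ (n C k) + + (n C suc k)) * (x * x ^ k)
      ≡⟨ distribute (+ (n C k)) (+ (n C suc k)) x (x ^ k) ⟩
    x * g k + g (suc k)
      ∎
    where distribute : ∀ a b x y → (a + b) * (x * y) ≡ x * (a * y) + b * (x * y)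
          distribute = solve-∀
  regroup : ∀ a b → 1ℤ + (a + b) ≡ a + (1ℤ + b)
  regroup = solve-∀
  factor : ∀ x y → x * y + y ≡ (1ℤ + x) * y
  factor = solve-∀

∑-k-binomial : ∀ x n N → n < N → ∑ (suc N) (λ k → + k * + (suc n C k) * x ^ k) ≡ + suc n * x * (1ℤ + x) ^ n
∑-k-binomial x n N n<N = begin
  ∑ (suc N) (λ k → + k * + (suc n C k) * x ^ k)
    ≡⟨ ∑-suc N _ ⟩
  0ℤ + ∑ N (λ k → + suc k * + (suc n C suc k) * x ^ suc k)
    ≡⟨ ℤ.+-identityˡ _ ⟩
  ∑ N (λ k → + suc k * + (suc n C suc k) * x ^ suc k)
    ≡⟨ ∑-cong N absorb ⟩
  ∑ N (λ k → (+ suc n * x) * (+ (n C k) * x ^ k))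
    ≡⟨ *-distribˡ-∑ N (+ suc n * x) _ ⟩
  + suc n * x * ∑ N (λ k → + (n C k) * x ^ k)
    ≡⟨ cong (+ suc n * x *_) (∑-binomial x n N n<N) ⟩
  + suc n * x * (1ℤ + x) ^ n
    ∎
  where
  open ≡-Reasoning
  absorb : ∀ k → + suc k * + (suc n C suc k) * x ^ suc k ≡ (+ suc n * x) * (+ (n C k) * x ^ k)
  absorb k = begin
    + suc k * + (suc n C suc k) * (x * x ^ k)
      ≡⟨ cong (_* (x * x ^ k)) (sym (ℤ.pos-* (suc k) (suc n C suc k))) ⟩
    + (suc k ℕ.* (suc n C suc k)) * (x * x ^ k)
      ≡⟨ cong (λ c → + c * (x * x ^ k)) (C-absorb n k) ⟩
    + (suc n ℕ.* (n C k)) * (x * x ^ k)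
      ≡⟨ cong (_* (x * x ^ k)) (ℤ.pos-* (suc n) (n C k)) ⟩
    + suc n * + (n C k) * (x * x ^ k)
      ≡⟨ rearrange (+ suc n) (+ (n C k)) x (x ^ k) ⟩
    (+ suc n * x) * (+ (n C k) * x ^ k)
      ∎
    where rearrange : ∀ a b x y → a * b * (x * y) ≡ (a * x) * (b * y)
          rearrange = solve-∀

∑-[1+k]-binomial : ∀ x n N → n < N →
  ∑ (suc N) (λ k → + suc k * + (suc n C k) * x ^ k) ≡ (1ℤ + x) ^ n * (1ℤ + + suc (suc n) * x)
∑-[1+k]-binomial x n N n<N = begin
  ∑ (suc N) (λ k → + suc k * + (suc n C k) * x ^ k)
    ≡⟨ ∑-cong (suc N) (λ k → split (+ k) (+ (suc n C k)) (x ^ k)) ⟩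
  ∑ (suc N) (λ k → + (suc n C k) * x ^ k + + k * + (suc n C k) * x ^ k)
    ≡⟨ ∑-distrib-+ (suc N) _ _ ⟩
  ∑ (suc N) (λ k → + (suc n C k) * x ^ k) + ∑ (suc N) (λ k → + k * + (suc n C k) * x ^ k)
    ≡⟨ cong₂ _+_ (∑-binomial x (suc n) (suc N) (s≤s n<N)) (∑-k-binomial x n N n<N) ⟩
  (1ℤ + x) ^ suc n + + suc n * x * (1ℤ + x) ^ n
    ≡⟨ factor x (+ suc n) ((1ℤ + x) ^ n) ⟩
  (1ℤ + x) ^ n * (1ℤ + + suc (suc n) * x)
    ∎
  where
  open ≡-Reasoning
  split : ∀ k b y → (1ℤ + k) * b * y ≡ b * y + k * b * y
  split = solve-∀
  factor : ∀ x n y → (1ℤ + x) * y + n * x * y ≡ y * (1ℤ + (1ℤ + n) * x)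
  factor = solve-∀

-- The matrix F over ℤ

F : ℤ → ℕ → ℕ → ℤ
F m zero    j       = 1ℤ
F m (suc i) zero    = 1ℤ
F m (suc i) (suc j) = F m i (suc j) + m * F m i j + F m (suc i) j

F-sym : ∀ m i j → F m i j ≡ F m j i
F-sym m zero    zero    = refl
F-sym m zero    (suc j) = refl
F-sym m (suc i) zero    = refl
F-sym m (suc i) (suc j)
  rewrite F-sym m i (suc j) | F-sym m i j | F-sym m (suc i) j = swap (F m (suc j) i) (m * F m j i) (F m j (suc i))
  where swap : ∀ a b c → a + b + c ≡ c + b + a
        swap = solve-∀

delannoy : ℤ → ℕ → ℕ → ℕ → ℤ
delannoy c N i j = ∑ N (λ k → + (i C k) * + (j C k) * c ^ k)

-- Pascal's rule in both binomials makes the mixed second difference of the summands at index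
-- k + 1 equal to c times the summand at index k.
delannoy-second-difference : ∀ c N i j →
  delannoy c (suc N) (suc i) (suc j) + delannoy c (suc N) i j ≡
  delannoy c (suc N) i (suc j) + delannoy c (suc N) (suc i) j + c * delannoy c N i j
delannoy-second-difference c N i j = begin
  delannoy c (suc N) (suc i) (suc j) + delannoy c (suc N) i j
    ≡⟨ cong₂ _+_ (∑-suc N _) (∑-suc N _) ⟩
  (1ℤ + ∑ N (T (suc i) (suc j))) + (1ℤ + ∑ N (T i j))
    ≡⟨ regroup (∑ N (T (suc i) (suc j))) (∑ N (T i j)) ⟩
  + 2 + (∑ N (T (suc i) (suc j)) + ∑ N (T i j))
    ≡⟨ cong (_+_ (+ 2)) (sym (∑-distrib-+ N _ _)) ⟩
  + 2 + ∑ N (λ k → T (suc i) (suc j) k + T i j k)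
    ≡⟨ cong (_+_ (+ 2)) (∑-cong N termwise) ⟩
  + 2 + ∑ N (λ k → T i (suc j) k + T (suc i) j k + c * E i j k)
    ≡⟨ cong (_+_ (+ 2)) (∑-distrib-+ N _ _) ⟩
  + 2 + (∑ N (λ k → T i (suc j) k + T (suc i) j k) + ∑ N (λ k → c * E i j k))
    ≡⟨ cong₂ (λ s t → + 2 + (s + t)) (∑-distrib-+ N _ _) (*-distribˡ-∑ N c (E i j)) ⟩
  + 2 + ((∑ N (T i (suc j)) + ∑ N (T (suc i) j)) + c * ∑ N (E i j))
    ≡⟨ sym (regroup′ (∑ N (T i (suc j))) (∑ N (T (suc i) j)) (c * ∑ N (E i j))) ⟩
  (1ℤ + ∑ N (T i (suc j))) + (1ℤ + ∑ N (T (suc i) j)) + c * ∑ N (E i j)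
    ≡⟨ cong (λ s → s + c * ∑ N (E i j)) (sym (cong₂ _+_ (∑-suc N _) (∑-suc N _))) ⟩
  delannoy c (suc N) i (suc j) + delannoy c (suc N) (suc i) j + c * delannoy c N i j
    ∎
  where
  open ≡-Reasoning
  E : ℕ → ℕ → ℕ → ℤ
  E a b k = + (a C k) * + (b C k) * c ^ k
  T : ℕ → ℕ → ℕ → ℤ
  T a b k = E a b (suc k)
  regroup : ∀ s t → (1ℤ + s) + (1ℤ + t) ≡ + 2 + (s + t)
  regroup = solve-∀
  regroup′ : ∀ s t u → (1ℤ + s) + (1ℤ + t) + u ≡ + 2 + ((s + t) + u)
  regroup′ = solve-∀
  pascal : ∀ a k → + (suc a C suc k) ≡ + (a C k) + + (a C suc k)
  pascal a k = trans (cong +_ (sym (nCk+nC[k+1]≡[n+1]C[k+1] a k))) (ℤ.pos-+ (a C k) (a C suc k))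
  expand : ∀ a a′ b b′ c w →
    (a + a′) * (b + b′) * (c * w) + a′ * b′ * (c * w) ≡
    a′ * (b + b′) * (c * w) + (a + a′) * b′ * (c * w) + c * (a * b * w)
  expand = solve-∀
  termwise : ∀ k → T (suc i) (suc j) k + T i j k ≡ T i (suc j) k + T (suc i) j k + c * E i j k
  termwise k = begin
    + I′ * + J′ * w + a′ * b′ * w
      ≡⟨ cong₂ (λ x y → x * y * w + a′ * b′ * w) (pascal i k) (pascal j k) ⟩
    (a + a′) * (b + b′) * w + a′ * b′ * w
      ≡⟨ expand a a′ b b′ c (c ^ k) ⟩
    a′ * (b + b′) * w + (a + a′) * b′ * w + c * (a * b * c ^ k)
      ≡⟨ sym (cong₂ (λ x y → a′ * x * w + y * b′ * w + c * (a * b * c ^ k)) (pascal j k) (pascal i k)) ⟩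
    a′ * + J′ * w + + I′ * b′ * w + c * (a * b * c ^ k)
      ∎
    where
    I′ = suc i C suc k
    J′ = suc j C suc k
    a  = + (i C k)
    a′ = + (i C suc k)
    b  = + (j C k)
    b′ = + (j C suc k)
    w  = c ^ suc k

F≡delannoy : ∀ m N i j → i < N → F m i j ≡ delannoy (1ℤ + m) N i j
F≡delannoy m (suc N) zero j _ =
  sym (trans (∑-suc N _) (cong (_+_ 1ℤ) (∑-vanishing N (λ _ → refl))))
F≡delannoy m (suc N) (suc i) zero _ =
  sym (trans (∑-suc N _) (cong (_+_ 1ℤ) (∑-vanishing N
    (λ k → cong (_* (1ℤ + m) ^ suc k) (ℤ.*-zeroʳ (+ (suc i C suc k)))))))
F≡delannoy m (suc N) (suc i) (suc j) (s≤s i<N) = begin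
  F m i (suc j) + m * F m i j + F m (suc i) j
    ≡⟨ cong₂ (λ x y → x + m * y + F m (suc i) j) (F≡delannoy m (suc N) i (suc j) i<N′) (F≡delannoy m (suc N) i j i<N′) ⟩
  D i (suc j) + m * D i j + F m (suc i) j
    ≡⟨ cong (_+_ (D i (suc j) + m * D i j)) (F≡delannoy m (suc N) (suc i) j (s≤s i<N)) ⟩
  D i (suc j) + m * D i j + D (suc i) j
    ≡⟨ cancel (D (suc i) (suc j)) (D i (suc j)) (D (suc i) j) (D i j) m second-difference ⟩
  D (suc i) (suc j)
    ∎
  where
  open ≡-Reasoning
  D = delannoy (1ℤ + m) (suc N)
  i<N′ = ℕ.m<n⇒m<1+n i<N
  second-difference : D (suc i) (suc j) + D i j ≡ D i (suc j) + D (suc i) j + (1ℤ + m) * D i j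
  second-difference = trans (delannoy-second-difference (1ℤ + m) N i j)
    (cong (λ d → D i (suc j) + D (suc i) j + (1ℤ + m) * d)
          (sym (∑-vanishing-last N _ (cong (λ c → + c * + (j C N) * (1ℤ + m) ^ N) (k>n⇒nCk≡0 i<N)))))
  cancel : ∀ x y z d m → x + d ≡ y + z + (1ℤ + m) * d → y + m * d + z ≡ x
  cancel x y z d m eq = begin
    y + m * d + z               ≡⟨ expand y z d m ⟩
    (y + z + (1ℤ + m) * d) - d  ≡⟨ cong (_- d) (sym eq) ⟩
    (x + d) - d                 ≡⟨ shrink x d ⟩
    x                           ∎
    where
    expand : ∀ y z d m → y + m * d + z ≡ (y + z + (1ℤ + m) * d) - d
    expand = solve-∀
    shrink : ∀ x d → (x + d) - d ≡ x
    shrink = solve-∀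

F-row1 : ∀ m j → F m 1 j ≡ 1ℤ + + j * (1ℤ + m)
F-row1 m zero    = refl
F-row1 m (suc j) rewrite F-row1 m j = step (+ j) m
  where step : ∀ j m → 1ℤ + m * 1ℤ + (1ℤ + j * (1ℤ + m)) ≡ 1ℤ + (1ℤ + j) * (1ℤ + m)
        step = solve-∀

F-row2 : ∀ m j → let c = 1ℤ + m; J = + j in
  + 2 * F m 2 j ≡ + 2 + + 4 * J * c + J * (J - 1ℤ) * c * c
F-row2 m zero    = refl
F-row2 m (suc j) = begin
  + 2 * (F m 1 (suc j) + m * F m 1 j + F m 2 j)
    ≡⟨ spread (F m 1 (suc j)) (F m 1 j) (F m 2 j) m ⟩
  + 2 * F m 1 (suc j) + + 2 * m * F m 1 j + + 2 * F m 2 j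
    ≡⟨ cong₂ (λ x y → + 2 * x + + 2 * m * y + + 2 * F m 2 j) (F-row1 m (suc j)) (F-row1 m j) ⟩
  + 2 * (1ℤ + (1ℤ + + j) * (1ℤ + m)) + + 2 * m * (1ℤ + + j * (1ℤ + m)) + + 2 * F m 2 j
    ≡⟨ cong (_+_ (+ 2 * (1ℤ + (1ℤ + + j) * (1ℤ + m)) + + 2 * m * (1ℤ + + j * (1ℤ + m)))) (F-row2 m j) ⟩
  + 2 * (1ℤ + (1ℤ + + j) * (1ℤ + m)) + + 2 * m * (1ℤ + + j * (1ℤ + m)) +
    (+ 2 + + 4 * + j * (1ℤ + m) + + j * (+ j - 1ℤ) * (1ℤ + m) * (1ℤ + m))
    ≡⟨ collect (+ j) m ⟩
  + 2 + + 4 * (1ℤ + + j) * (1ℤ + m) + (1ℤ + + j) * (1ℤ + + j - 1ℤ) * (1ℤ + m) * (1ℤ + m)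
    ∎
  where
  open ≡-Reasoning
  spread : ∀ x y z m → + 2 * (x + m * y + z) ≡ + 2 * x + + 2 * m * y + + 2 * z
  spread = solve-∀
  collect : ∀ j m → + 2 * (1ℤ + (1ℤ + j) * (1ℤ + m)) + + 2 * m * (1ℤ + j * (1ℤ + m)) +
                    (+ 2 + + 4 * j * (1ℤ + m) + j * (j - 1ℤ) * (1ℤ + m) * (1ℤ + m)) ≡
                    + 2 + + 4 * (1ℤ + j) * (1ℤ + m) + (1ℤ + j) * (1ℤ + j - 1ℤ) * (1ℤ + m) * (1ℤ + m)
  collect = solve-∀

F-row3 : ∀ m j → let c = 1ℤ + m; J = + j in
  + 6 * F m 3 j ≡ + 6 + + 18 * J * c + + 9 * J * (J - 1ℤ) * c * c + J * (J - 1ℤ) * (J - + 2) * c * c * c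
F-row3 m zero    = refl
F-row3 m (suc j) = begin
  + 6 * (F m 2 (suc j) + m * F m 2 j + F m 3 j)
    ≡⟨ spread (F m 2 (suc j)) (F m 2 j) (F m 3 j) m ⟩
  + 3 * (+ 2 * F m 2 (suc j)) + + 3 * m * (+ 2 * F m 2 j) + + 6 * F m 3 j
    ≡⟨ cong₂ (λ x y → + 3 * x + + 3 * m * y + + 6 * F m 3 j) (F-row2 m (suc j)) (F-row2 m j) ⟩
  + 3 * (+ 2 + + 4 * (1ℤ + J) * c + (1ℤ + J) * (1ℤ + J - 1ℤ) * c * c) +
    + 3 * m * (+ 2 + + 4 * J * c + J * (J - 1ℤ) * c * c) + + 6 * F m 3 j
    ≡⟨ cong (_+_ (+ 3 * (+ 2 + + 4 * (1ℤ + J) * c + (1ℤ + J) * (1ℤ + J - 1ℤ) * c * c) +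
                  + 3 * m * (+ 2 + + 4 * J * c + J * (J - 1ℤ) * c * c))) (F-row3 m j) ⟩
  + 3 * (+ 2 + + 4 * (1ℤ + J) * c + (1ℤ + J) * (1ℤ + J - 1ℤ) * c * c) +
    + 3 * m * (+ 2 + + 4 * J * c + J * (J - 1ℤ) * c * c) +
    (+ 6 + + 18 * J * c + + 9 * J * (J - 1ℤ) * c * c + J * (J - 1ℤ) * (J - + 2) * c * c * c)
    ≡⟨ collect J m ⟩
  + 6 + + 18 * (1ℤ + J) * c + + 9 * (1ℤ + J) * (1ℤ + J - 1ℤ) * c * c + (1ℤ + J) * (1ℤ + J - 1ℤ) * (1ℤ + J - + 2) * c * c * c
    ∎
  where
  open ≡-Reasoning
  c = 1ℤ + m
  J = + j
  spread : ∀ x y z m → + 6 * (x + m * y + z) ≡ + 3 * (+ 2 * x) + + 3 * m * (+ 2 * y) + + 6 * z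
  spread = solve-∀
  collect : ∀ J m → let c = 1ℤ + m in
    + 3 * (+ 2 + + 4 * (1ℤ + J) * c + (1ℤ + J) * (1ℤ + J - 1ℤ) * c * c) +
    + 3 * m * (+ 2 + + 4 * J * c + J * (J - 1ℤ) * c * c) +
    (+ 6 + + 18 * J * c + + 9 * J * (J - 1ℤ) * c * c + J * (J - 1ℤ) * (J - + 2) * c * c * c) ≡
    + 6 + + 18 * (1ℤ + J) * c + + 9 * (1ℤ + J) * (1ℤ + J - 1ℤ) * c * c + (1ℤ + J) * (1ℤ + J - 1ℤ) * (1ℤ + J - + 2) * c * c * c
  collect = solve-∀

-- Congruences modulo n

module Modulo (n : ℕ) where

  infix 4 _≈_
  record _≈_ (x y : ℤ) : Set where
    constructor ≈-by
    field divides-difference : + n ∣ x - y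

  ≈-reflexive : ∀ {x y} → x ≡ y → x ≈ y
  ≈-reflexive {x} refl = ≈-by (divides 0ℤ (ℤ.+-inverseʳ x))

  ≈-refl : ∀ {x} → x ≈ x
  ≈-refl = ≈-reflexive refl

  ≈-sym : ∀ {x y} → x ≈ y → y ≈ x
  ≈-sym {x} {y} (≈-by d) = ≈-by (subst (+ n ∣_) (negate x y) (∣m⇒∣-m d))
    where negate : ∀ x y → - (x - y) ≡ y - x
          negate = solve-∀

  ≈-trans : ∀ {x y z} → x ≈ y → y ≈ z → x ≈ z
  ≈-trans {x} {y} {z} (≈-by d) (≈-by e) = ≈-by (subst (+ n ∣_) (telescope x y z) (∣m∣n⇒∣m+n d e))
    where telescope : ∀ x y z → (x - y) + (y - z) ≡ x - z
          telescope = solve-∀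

  ≈-setoid : Setoid 0ℓ 0ℓ
  ≈-setoid = record
    { Carrier = ℤ ; _≈_ = _≈_
    ; isEquivalence = record { refl = ≈-refl ; sym = ≈-sym ; trans = ≈-trans } }

  +-cong : ∀ {x y u v} → x ≈ y → u ≈ v → x + u ≈ y + v
  +-cong {x} {y} {u} {v} (≈-by d) (≈-by e) = ≈-by (subst (+ n ∣_) (regroup x y u v) (∣m∣n⇒∣m+n d e))
    where regroup : ∀ x y u v → (x - y) + (u - v) ≡ (x + u) - (y + v)
          regroup = solve-∀

  *-cong : ∀ {x y u v} → x ≈ y → u ≈ v → x * u ≈ y * v
  *-cong {x} {y} {u} {v} (≈-by d) (≈-by e) =
    ≈-by (subst (+ n ∣_) (regroup x y u v) (∣m∣n⇒∣m+n (∣n⇒∣m*n u d) (∣n⇒∣m*n y e)))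
    where regroup : ∀ x y u v → u * (x - y) + y * (u - v) ≡ x * u - y * v
          regroup = solve-∀

  ≈-by-multiple : ∀ k {x y} → x ≡ y + k * + n → x ≈ y
  ≈-by-multiple k {x} {y} refl = ≈-by (divides k (cancel y (k * + n)))
    where cancel : ∀ y z → y + z - y ≡ z
          cancel = solve-∀

  n≈0 : + n ≈ 0ℤ
  n≈0 = ≈-by-multiple 1ℤ (sym (trans (ℤ.+-identityˡ (1ℤ * + n)) (ℤ.*-identityˡ (+ n))))

  ≈0⇒∣ : ∀ {x} → x ≈ 0ℤ → + n ∣ x
  ≈0⇒∣ {x} (≈-by n∣x-0) = subst (+ n ∣_) (ℤ.+-identityʳ x) n∣x-0

  ∣⇒≈0 : ∀ {x} → + n ∣ x → x ≈ 0ℤ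
  ∣⇒≈0 {x} n∣x = ≈-by (subst (+ n ∣_) (sym (ℤ.+-identityʳ x)) n∣x)

  ∑-cong≈ : ∀ N {f g : ℕ → ℤ} → (∀ k → k < N → f k ≈ g k) → ∑ N f ≈ ∑ N g
  ∑-cong≈ zero    f≈g = ≈-refl
  ∑-cong≈ (suc N) f≈g = +-cong (∑-cong≈ N (λ k k<N → f≈g k (ℕ.m<n⇒m<1+n k<N))) (f≈g N (ℕ.n<1+n N))

  F-cong : ∀ {m m′} → m ≈ m′ → ∀ i j → F m i j ≈ F m′ i j
  F-cong m≈m′ zero    j       = ≈-refl
  F-cong m≈m′ (suc i) zero    = ≈-refl
  F-cong m≈m′ (suc i) (suc j) =
    +-cong (+-cong (F-cong m≈m′ i (suc j)) (*-cong m≈m′ (F-cong m≈m′ i j))) (F-cong m≈m′ (suc i) j)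

  module _ .{{_ : NonZero n}} where

    %ℕ-≈ : ∀ x → + (x %ℕ n) ≈ x
    %ℕ-≈ x = ≈-sym (≈-by-multiple (x /ℕ n) (a≡a%ℕn+[a/ℕn]*n x n))

    entry≈F : ∀ m i j → + entry n m i j ≈ F (+ m) i j
    entry≈F m zero    j       = %ℕ-≈ 1ℤ
    entry≈F m (suc i) zero    = %ℕ-≈ 1ℤ
    entry≈F m (suc i) (suc j) = ≈-trans (%ℕ-≈ (+ (a ℕ.+ m ℕ.* b ℕ.+ c))) (≈-trans (≈-reflexive cast)
      (+-cong (+-cong (entry≈F m i (suc j)) (*-cong (≈-refl {+ m}) (entry≈F m i j))) (entry≈F m (suc i) j)))
      where
      a = entry n m i (suc j)
      b = entry n m i j
      c = entry n m (suc i) j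
      cast : + (a ℕ.+ m ℕ.* b ℕ.+ c) ≡ + a + + m * + b + + c
      cast = trans (ℤ.pos-+ (a ℕ.+ m ℕ.* b) c)
                   (cong (_+ + c) (trans (ℤ.pos-+ a (m ℕ.* b)) (cong (_+_ (+ a)) (ℤ.pos-* m b))))

    entry<n : ∀ m i j → entry n m i j < n
    entry<n m zero    j       = m%n<n 1 n
    entry<n m (suc i) zero    = m%n<n 1 n
    entry<n m (suc i) (suc j) = m%n<n _ n

    entry≡0 : ∀ {m i j} → F (+ m) i j ≈ 0ℤ → entry n m i j ≡ 0
    entry≡0 {m} {i} {j} F≈0 = trans (sym (m<n⇒m%n≡m (entry<n m i j)))
      (n∣m⇒m%n≡0 _ n (∣⇒∣ᵤ (≈0⇒∣ (≈-trans (entry≈F m i j) F≈0))))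

  negated-inverse : Prime n → ∀ m → suc m < n → ∃[ j ] (j < n × + j * + suc m + 1ℤ ≈ 0ℤ)
  negated-inverse n-prime m m<n = reduce (bézout (coprime-Bézout (prime⇒coprime n-prime m<n)))
    where
    open ≡-Reasoning
    instance _ = prime⇒nonZero n-prime
    c = + suc m
    lift : ∀ {a b d e} → 1 ℕ.+ a ℕ.* b ≡ d ℕ.* e → 1ℤ + + a * + b ≡ + d * + e
    lift {a} {b} {d} {e} eq =
      trans (cong (_+_ 1ℤ) (sym (ℤ.pos-* a b))) (trans (cong +_ eq) (ℤ.pos-* d e))
    bézout : Bézout.Identity 1 n (suc m) → ∃[ y ] (y * c + 1ℤ ≈ 0ℤ)
    bézout (Bézout.+- x y eq) = + y , ≈-by-multiple (+ x) (begin
      + y * c + 1ℤ       ≡⟨ ℤ.+-comm (+ y * c) 1ℤ ⟩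
      1ℤ + + y * c       ≡⟨ lift {y} {suc m} {x} {n} eq ⟩
      + x * + n          ≡⟨ ℤ.+-identityˡ (+ x * + n) ⟨
      0ℤ + + x * + n     ∎)
    bézout (Bézout.-+ x y eq) = - + y , ≈-by-multiple (- + x) (begin
      - + y * c + 1ℤ               ≡⟨ negate (+ y) c ⟩
      1ℤ - + y * c                 ≡⟨ cong (_-_ 1ℤ) (lift {x} {n} {y} {suc m} eq) ⟨
      1ℤ - (1ℤ + + x * + n)        ≡⟨ cancel (+ x) (+ n) ⟩
      0ℤ + - + x * + n             ∎)
      where
      negate : ∀ y c → - y * c + 1ℤ ≡ 1ℤ - y * c
      negate = solve-∀
      cancel : ∀ x n → 1ℤ - (1ℤ + x * n) ≡ 0ℤ + - x * n
      cancel = solve-∀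
    reduce : ∃[ y ] (y * c + 1ℤ ≈ 0ℤ) → ∃[ j ] (j < n × + j * c + 1ℤ ≈ 0ℤ)
    reduce (y , y*c+1≈0) = y %ℕ n , n%ℕd<d y n , ≈-trans (+-cong (*-cong (%ℕ-≈ y) ≈-refl) ≈-refl) y*c+1≈0

  *-cancelˡ-≈0 : Prime n → ∀ {d} x → ¬ (n ℕ∣ d) → + d * x ≈ 0ℤ → x ≈ 0ℤ
  *-cancelˡ-≈0 n-prime {d} x n∤d dx≈0
    with euclidsLemma d ∣ x ∣ n-prime (subst (n ℕ∣_) (ℤ.abs-* (+ d) x) (∣⇒∣ᵤ (≈0⇒∣ dx≈0)))
  ... | inj₁ n∣d   = contradiction n∣d n∤d
  ... | inj₂ n∣∣x∣ = ∣⇒≈0 (∣ᵤ⇒∣ n∣∣x∣)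

  F-row1-zero : ∀ m j → + j * (1ℤ + m) + 1ℤ ≈ 0ℤ → F m 1 j ≈ 0ℤ
  F-row1-zero m j j*c+1≈0 = ≈-trans (≈-reflexive (trans (F-row1 m j) (ℤ.+-comm 1ℤ (+ j * (1ℤ + m))))) j*c+1≈0

  -- c ≡ -1 means m ≡ -2, and F (-2) 3 3 and F (-2) 5 5 are already 0 over ℤ.
  F-diagonal-zeros : ∀ m → (1ℤ + m) + 1ℤ ≈ 0ℤ → F m 3 3 ≈ 0ℤ × F m 5 5 ≈ 0ℤ
  F-diagonal-zeros m c+1≈0 = F-cong m≈-2 3 3 , F-cong m≈-2 5 5
    where
    m≈-2 : m ≈ - + 2
    m≈-2 = ≈-by (subst (+ n ∣_) (shift m) (≈0⇒∣ c+1≈0))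
      where shift : ∀ m → (1ℤ + m) + 1ℤ ≡ m - - + 2
            shift = solve-∀

  -- 8 · 6 F(3, r) is a polynomial in r and 2c which vanishes at r = -4, 2c = 1.
  F-row3-zero : Prime n → 3 < n → ∀ m r → + 2 * (1ℤ + m) ≈ 1ℤ → + 4 + + r ≈ 0ℤ → F m 3 r ≈ 0ℤ
  F-row3-zero n-prime 3<n m r 2c≈1 4+r≈0 =
    cancel3 (cancel2 (cancel2 (cancel2 (cancel2 (≈-trans (≈-reflexive (factor (F m 3 r))) 48F≈0)))))
    where
    factor : ∀ x → + 2 * (+ 2 * (+ 2 * (+ 2 * (+ 3 * x)))) ≡ + 48 * x
    factor = solve-∀
    c = 1ℤ + m
    quartic : ℤ → ℤ → ℤ
    quartic J u = + 48 + + 72 * J * u + + 18 * J * (J - 1ℤ) * u * u + J * (J - 1ℤ) * (J - + 2) * u * u * u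
    quartic-cong : ∀ {J J′ u u′} → J ≈ J′ → u ≈ u′ → quartic J u ≈ quartic J′ u′
    quartic-cong J≈J′ u≈u′ =
      +-cong (+-cong (+-cong (≈-refl {+ 48}) (*-cong (*-cong (≈-refl {+ 72}) J≈J′) u≈u′))
                     (*-cong (*-cong (*-cong (*-cong (≈-refl {+ 18}) J≈J′) J-1≈) u≈u′) u≈u′))
             (*-cong (*-cong (*-cong (*-cong (*-cong J≈J′ J-1≈) J-2≈) u≈u′) u≈u′) u≈u′)
      where
      J-1≈ = +-cong J≈J′ (≈-refl { -1ℤ})
      J-2≈ = +-cong J≈J′ (≈-refl { - + 2})
    r≈-4 : + r ≈ - + 4
    r≈-4 = ≈-by (subst (+ n ∣_) (shift (+ r)) (≈0⇒∣ 4+r≈0))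
      where shift : ∀ r → + 4 + r ≡ r - - + 4
            shift = solve-∀
    scale : ∀ J c y → + 6 * y ≡ + 6 + + 18 * J * c + + 9 * J * (J - 1ℤ) * c * c + J * (J - 1ℤ) * (J - + 2) * c * c * c →
            + 48 * y ≡ quartic J (+ 2 * c)
    scale J c y 6y≡cubic = trans (eight y) (trans (cong (+ 8 *_) 6y≡cubic) (expand J c))
      where
      eight : ∀ y → + 48 * y ≡ + 8 * (+ 6 * y)
      eight = solve-∀
      expand : ∀ J c → + 8 * (+ 6 + + 18 * J * c + + 9 * J * (J - 1ℤ) * c * c + J * (J - 1ℤ) * (J - + 2) * c * c * c) ≡
        + 48 + + 72 * J * (+ 2 * c) + + 18 * J * (J - 1ℤ) * (+ 2 * c) * (+ 2 * c) +
        J * (J - 1ℤ) * (J - + 2) * (+ 2 * c) * (+ 2 * c) * (+ 2 * c)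
      expand = solve-∀
    48F≈0 : + 48 * F m 3 r ≈ 0ℤ
    48F≈0 = ≈-trans (≈-reflexive (scale (+ r) c (F m 3 r) (F-row3 m r))) (quartic-cong r≈-4 2c≈1)
    cancel2 : ∀ {x} → + 2 * x ≈ 0ℤ → x ≈ 0ℤ
    cancel2 = *-cancelˡ-≈0 n-prime _ (>⇒∤ (ℕ.<-trans (ℕ.n<1+n 2) 3<n))
    cancel3 : ∀ {x} → + 3 * x ≈ 0ℤ → x ≈ 0ℤ
    cancel3 = *-cancelˡ-≈0 n-prime _ (>⇒∤ 3<n)

-- Binomial coefficients and the row q of F modulo the prime q + 2

module ModuloPrime (q : ℕ) (p-prime : Prime (suc (suc q))) where

  p : ℕ
  p = suc (suc q)

  open Modulo p

  C[p-1,k]≈ : ∀ k → k ≤ suc q → + (suc q C k) ≈ -1ℤ ^ k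
  C[p-1,k]≈ zero    _         = ≈-refl
  C[p-1,k]≈ (suc k) (s≤s k≤q) = begin
    + (suc q C suc k)                    ≡⟨ pascal-difference (suc q) k ⟩
    + (p C suc k) + -1ℤ * + (suc q C k)  ≈⟨ +-cong p∣C (*-cong (≈-refl { -1ℤ}) (C[p-1,k]≈ k (ℕ.m≤n⇒m≤1+n k≤q))) ⟩
    0ℤ + -1ℤ * -1ℤ ^ k                   ≡⟨ ℤ.+-identityˡ (-1ℤ ^ suc k) ⟩
    -1ℤ ^ suc k                          ∎
    where
    open ≈-Reasoning ≈-setoid
    p∣C : + (p C suc k) ≈ 0ℤ
    p∣C = ∣⇒≈0 (∣ᵤ⇒∣ (p∣pC[1+k] p-prime (s≤s k≤q)))

  C[p-2,k]≈ : ∀ k → k ≤ suc q → + (q C k) ≈ -1ℤ ^ k * + suc k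
  C[p-2,k]≈ zero    _         = ≈-refl
  C[p-2,k]≈ (suc k) (s≤s k≤q) = begin
    + (q C suc k)                                ≡⟨ pascal-difference q k ⟩
    + (suc q C suc k) + -1ℤ * + (q C k)          ≈⟨ +-cong (C[p-1,k]≈ (suc k) (s≤s k≤q))
                                                          (*-cong (≈-refl { -1ℤ}) (C[p-2,k]≈ k (ℕ.m≤n⇒m≤1+n k≤q))) ⟩
    -1ℤ ^ suc k + -1ℤ * (-1ℤ ^ k * + suc k)      ≡⟨ collect (-1ℤ ^ k) (+ k) ⟩
    -1ℤ ^ suc k * + suc (suc k)                  ∎
    where
    open ≈-Reasoning ≈-setoid
    collect : ∀ s k → -1ℤ * s + -1ℤ * (s * (1ℤ + k)) ≡ (-1ℤ * s) * (1ℤ + (1ℤ + k))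
    collect = solve-∀

  F-row[p-2] : ∀ m j → j < q → let c = 1ℤ + m in
    F m q (suc j) ≈ (1ℤ - c) ^ j * (1ℤ - + suc (suc j) * c)
  F-row[p-2] m j j<q = begin
    F m q (suc j)
      ≡⟨ F≡delannoy m (suc q) q (suc j) (ℕ.n<1+n q) ⟩
    ∑ (suc q) (λ k → + (q C k) * + (suc j C k) * c ^ k)
      ≈⟨ ∑-cong≈ (suc q) (λ k k<1+q → *-cong (*-cong (C[p-2,k]≈ k (ℕ.<⇒≤ k<1+q)) ≈-refl) ≈-refl) ⟩
    ∑ (suc q) (λ k → -1ℤ ^ k * + suc k * + (suc j C k) * c ^ k)
      ≡⟨ ∑-cong (suc q) sign-into-power ⟩
    ∑ (suc q) (λ k → + suc k * + (suc j C k) * (- c) ^ k)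
      ≡⟨ ∑-[1+k]-binomial (- c) j q j<q ⟩
    (1ℤ - c) ^ j * (1ℤ + + suc (suc j) * - c)
      ≡⟨ cong (λ x → (1ℤ - c) ^ j * (1ℤ + x)) (sym (ℤ.neg-distribʳ-* (+ suc (suc j)) c)) ⟩
    (1ℤ - c) ^ j * (1ℤ - + suc (suc j) * c)
      ∎
    where
    open ≈-Reasoning ≈-setoid
    c = 1ℤ + m
    regroup : ∀ s k b w → s * k * b * w ≡ k * b * (s * w)
    regroup = solve-∀
    sign-into-power : ∀ k → -1ℤ ^ k * + suc k * + (suc j C k) * c ^ k ≡ + suc k * + (suc j C k) * (- c) ^ k
    sign-into-power k = trans (regroup (-1ℤ ^ k) (+ suc k) (+ (suc j C k)) (c ^ k))
                              (cong (+ suc k * + (suc j C k) *_) (-1^k*x^k≡[-x]^k c k))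

  F-row[p-2]-zero : ∀ m t k → t ℕ.+ suc k ≡ q → + suc t * (1ℤ + m) + 1ℤ ≈ 0ℤ → F m q (suc k) ≈ 0ℤ
  F-row[p-2]-zero m t k t+1+k≡q j₀c+1≈0 = begin
    F m q (suc k)                           ≈⟨ F-row[p-2] m k k<q ⟩
    (1ℤ - c) ^ k * (1ℤ - + suc (suc k) * c)  ≈⟨ *-cong (≈-refl {(1ℤ - c) ^ k}) factor≈0 ⟩
    (1ℤ - c) ^ k * 0ℤ                       ≡⟨ ℤ.*-zeroʳ ((1ℤ - c) ^ k) ⟩
    0ℤ                                      ∎
    where
    open ≈-Reasoning ≈-setoid
    c = 1ℤ + m
    k<q : k < q
    k<q = subst (k <_) t+1+k≡q (ℕ.m≤n+m (suc k) t)
    identity : ∀ t k c → 1ℤ - (+ 2 + k) * c ≡ ((1ℤ + t) * c + 1ℤ) + - c * (+ 2 + (t + (1ℤ + k)))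
    identity = solve-∀
    factor≈0 : 1ℤ - + suc (suc k) * c ≈ 0ℤ
    factor≈0 = ≈-trans (≈-by-multiple (- c) (trans (identity (+ t) (+ k) c)
      (cong (λ z → (+ suc t * c + 1ℤ) + - c * + suc (suc z)) t+1+k≡q))) j₀c+1≈0

  F-row[p-2]-zero-at-2 : 1 < q → ∀ m → + suc q * (1ℤ + m) + 1ℤ ≈ 0ℤ → F m q 2 ≈ 0ℤ
  F-row[p-2]-zero-at-2 1<q m j₀c+1≈0 =
    ≈-trans (F-row[p-2] m 1 1<q) (*-cong (*-cong 1-c≈0 (≈-refl {1ℤ})) ≈-refl)
    where
    c = 1ℤ + m
    identity : ∀ q c → 1ℤ - c ≡ ((1ℤ + q) * c + 1ℤ) + - c * (+ 2 + q)
    identity = solve-∀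
    1-c≈0 : 1ℤ - c ≈ 0ℤ
    1-c≈0 = ≈-trans (≈-by-multiple (- c) (identity (+ q) c)) j₀c+1≈0

indicator : ∀ {a} {A : Set a} → Dec A → ℕ
indicator A? = if does A? then 1 else 0

sum-map-+ : ∀ {a} {A : Set a} (xs : List A) (f g : A → ℕ) →
  sum (map (λ x → f x ℕ.+ g x) xs) ≡ sum (map f xs) ℕ.+ sum (map g xs)
sum-map-+ []       f g = refl
sum-map-+ (x ∷ xs) f g rewrite sum-map-+ xs f g = interchange (f x) (g x) (sum (map f xs)) (sum (map g xs))
  where interchange : ∀ a b c d → a ℕ.+ b ℕ.+ (c ℕ.+ d) ≡ a ℕ.+ c ℕ.+ (b ℕ.+ d)
        interchange = ℕ-Solver.solve-∀

sum-map-*ˡ : ∀ {a} {A : Set a} (xs : List A) c (f : A → ℕ) →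
  sum (map (λ x → c ℕ.* f x) xs) ≡ c ℕ.* sum (map f xs)
sum-map-*ˡ []       c f = sym (ℕ.*-zeroʳ c)
sum-map-*ˡ (x ∷ xs) c f rewrite sum-map-*ˡ xs c f = sym (ℕ.*-distribˡ-+ c (f x) (sum (map f xs)))

sum-map-0 : ∀ {a} {A : Set a} (xs : List A) → sum (map (λ _ → 0) xs) ≡ 0
sum-map-0 []       = refl
sum-map-0 (x ∷ xs) = sum-map-0 xs

sum-map-mono-≤ : ∀ {a} {A : Set a} (xs : List A) {f g : A → ℕ} →
  (∀ x → f x ≤ g x) → sum (map f xs) ≤ sum (map g xs)
sum-map-mono-≤ []       f≤g = z≤n
sum-map-mono-≤ (x ∷ xs) f≤g = ℕ.+-mono-≤ (f≤g x) (sum-map-mono-≤ xs f≤g)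

sum-indicator-upTo : ∀ {a n} → a < n → sum (map (λ i → indicator (a ℕ.≟ i)) (upTo n)) ≡ 1
sum-indicator-upTo {a} {n} a<n = trans (cong sum (map-upTo _ n)) (go a n a<n)
  where
  zeros : ∀ n → sum (applyUpTo (λ _ → 0) n) ≡ 0
  zeros zero    = refl
  zeros (suc n) = zeros n
  go : ∀ a n → a < n → sum (applyUpTo (λ i → indicator (a ℕ.≟ i)) n) ≡ 1
  go zero    (suc n) _         = cong suc (zeros n)
  go (suc a) (suc n) (s≤s a<n) = go a n a<n

indicator-yes : ∀ {a} {A : Set a} (A? : Dec A) → A → indicator A? ≡ 1
indicator-yes A? a = cong (if_then 1 else 0) (dec-true A? a)

indicator-no : ∀ {a} {A : Set a} (A? : Dec A) → ¬ A → indicator A? ≡ 0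
indicator-no A? ¬a = cong (if_then 1 else 0) (dec-false A? ¬a)

indicator-pair-≢ : ∀ {a b i j} → (a , b) ≢ (i , j) → indicator (a ℕ.≟ i) ℕ.* indicator (b ℕ.≟ j) ≡ 0
indicator-pair-≢ {a} {b} {i} {j} ab≢ij with a ℕ.≟ i
... | no a≢i   = cong (ℕ._* indicator (b ℕ.≟ j)) (indicator-no (a ℕ.≟ i) a≢i)
... | yes refl = trans (cong (indicator (a ℕ.≟ a) ℕ.*_) (indicator-no (b ℕ.≟ j) (ab≢ij ∘ cong (a ,_))))
                       (ℕ.*-zeroʳ (indicator (a ℕ.≟ a)))

gridSum : ℕ → (ℕ → ℕ → ℕ) → ℕ
gridSum n f = sum (map (λ i → sum (map (λ j → f i j) (upTo n))) (upTo n))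

gridSum-+ : ∀ n (f g : ℕ → ℕ → ℕ) → gridSum n (λ i j → f i j ℕ.+ g i j) ≡ gridSum n f ℕ.+ gridSum n g
gridSum-+ n f g =
  trans (cong sum (map-cong (λ i → sum-map-+ (upTo n) (f i) (g i)) (upTo n))) (sum-map-+ (upTo n) _ _)

gridSum-mono-≤ : ∀ n {f g : ℕ → ℕ → ℕ} → (∀ i j → f i j ≤ g i j) → gridSum n f ≤ gridSum n g
gridSum-mono-≤ n f≤g = sum-map-mono-≤ (upTo n) (λ i → sum-map-mono-≤ (upTo n) (f≤g i))

gridSum-point : ∀ {n a b} → a < n → b < n → gridSum n (λ i j → indicator (a ℕ.≟ i) ℕ.* indicator (b ℕ.≟ j)) ≡ 1
gridSum-point {n} {a} {b} a<n b<n =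
  trans (cong sum (map-cong row (upTo n))) (sum-indicator-upTo a<n)
  where
  row : ∀ i → sum (map (λ j → indicator (a ℕ.≟ i) ℕ.* indicator (b ℕ.≟ j)) (upTo n)) ≡ indicator (a ℕ.≟ i)
  row i = trans (sum-map-*ˡ (upTo n) (indicator (a ℕ.≟ i)) (λ j → indicator (b ℕ.≟ j)))
                (trans (cong (indicator (a ℕ.≟ i) ℕ.*_) (sum-indicator-upTo b<n)) (ℕ.*-identityʳ _))

gridSum-0 : ∀ n → gridSum n (λ _ _ → 0) ≡ 0
gridSum-0 n = trans (cong sum (map-cong (λ _ → sum-map-0 (upTo n)) (upTo n))) (sum-map-0 (upTo n))

module Grid {ℓ} {P : ℕ → ℕ → Set ℓ} (P? : ∀ i j → Dec (P i j)) where

  gridCount : ℕ → ℕ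
  gridCount n = gridSum n (λ i j → indicator (P? i j))

  occurrences : List (ℕ × ℕ) → ℕ → ℕ → ℕ
  occurrences []             i j = 0
  occurrences ((a , b) ∷ xs) i j = indicator (a ℕ.≟ i) ℕ.* indicator (b ℕ.≟ j) ℕ.+ occurrences xs i j

  gridSum-occurrences : ∀ n xs → All (λ (i , j) → i < n × j < n) xs → gridSum n (occurrences xs) ≡ length xs
  gridSum-occurrences n []             _                        = gridSum-0 n
  gridSum-occurrences n ((a , b) ∷ xs) ((a<n , b<n) ∷ xs∈grid) =
    trans (gridSum-+ n _ (occurrences xs)) (cong₂ ℕ._+_ (gridSum-point a<n b<n) (gridSum-occurrences n xs xs∈grid))

  occurrences-absent : ∀ {i j} xs → All ((i , j) ≢_) xs → occurrences xs i j ≡ 0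
  occurrences-absent []             []               = refl
  occurrences-absent ((a , b) ∷ xs) (ij≢ab ∷ ij∉xs) =
    cong₂ ℕ._+_ (indicator-pair-≢ (ij≢ab ∘ sym)) (occurrences-absent xs ij∉xs)

  occurrences≤indicator : ∀ xs → Unique xs → All (λ (a , b) → P a b) xs →
    ∀ i j → occurrences xs i j ≤ indicator (P? i j)
  occurrences≤indicator []             _                _           i j = z≤n
  occurrences≤indicator ((a , b) ∷ xs) (ab∉xs ∷ unique) (Pab ∷ Pxs) i j
    with ≡-dec ℕ._≟_ ℕ._≟_ (a , b) (i , j)
  ... | yes refl = ℕ.≤-reflexive (begin
    indicator (a ℕ.≟ a) ℕ.* indicator (b ℕ.≟ b) ℕ.+ occurrences xs a b
      ≡⟨ cong₂ ℕ._+_ (cong₂ ℕ._*_ (indicator-yes (a ℕ.≟ a) refl) (indicator-yes (b ℕ.≟ b) refl))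
                     (occurrences-absent xs ab∉xs) ⟩
    1
      ≡⟨ sym (indicator-yes (P? a b) Pab) ⟩
    indicator (P? a b)
      ∎)
    where open ≡-Reasoning
  ... | no ab≢ij = ℕ.≤-trans (ℕ.≤-reflexive (cong (ℕ._+ occurrences xs i j) (indicator-pair-≢ ab≢ij)))
                             (occurrences≤indicator xs unique Pxs i j)

  length≤gridCount : ∀ n xs → Unique xs → All (λ (i , j) → i < n × j < n × P i j) xs → length xs ≤ gridCount n
  length≤gridCount n xs unique marked = begin
    length xs                   ≡⟨ gridSum-occurrences n xs (All.map (λ (i<n , j<n , _) → i<n , j<n) marked) ⟨
    gridSum n (occurrences xs)  ≤⟨ gridSum-mono-≤ n (occurrences≤indicator xs unique (All.map (λ (_ , _ , P) → P) marked)) ⟩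
    gridCount n                 ∎
    where open ℕ.≤-Reasoning

-- The zeros of F(p, m)

module Zeros (s : ℕ) (p-prime : Prime (7 ℕ.+ s)) (m : ℕ) where

  q : ℕ
  q = 5 ℕ.+ s

  open ModuloPrime q p-prime
  open Modulo p

  a<1+a+b : ∀ {a b} → a < suc a ℕ.+ b
  a<1+a+b {a} {b} = ℕ.m≤m+n (suc a) b

  q<p : q < p
  q<p = s≤s (ℕ.n≤1+n q)

  ZeroOf : ℕ × ℕ → Set
  ZeroOf (i , j) = i < p × j < p × F (+ m) i j ≈ 0ℤ

  transpose : ∀ {i j} → ZeroOf (i , j) → ZeroOf (j , i)
  transpose {i} {j} (i<p , j<p , F≈0) = j<p , i<p , ≈-trans (≈-reflexive (F-sym (+ m) j i)) F≈0

  length≤zeroCount : ∀ xs → Unique xs → All ZeroOf xs → length xs ≤ zeroCount p m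
  length≤zeroCount xs unique zeros =
    Grid.length≤gridCount (λ i j → entry p m i j ℕ.≟ 0) p xs unique (All.map zero-entry zeros)
    where
    zero-entry : ∀ {x} → ZeroOf x → let (i , j) = x in i < p × j < p × entry p m i j ≡ 0
    zero-entry {i , j} (i<p , j<p , F≈0) = i<p , j<p , entry≡0 {m} {i} {j} F≈0

  Bounds : Set
  Bounds = 3 ≤ zeroCount p m × (s ≢ 0 → 4 ≤ zeroCount p m)

  four-zeros : ∀ w x y z → Unique (w ∷ x ∷ y ∷ z ∷ []) → All ZeroOf (w ∷ x ∷ y ∷ z ∷ []) → Bounds
  four-zeros _ _ _ _ unique zeros = ℕ.≤-trans (ℕ.n≤1+n 3) four , λ _ → four
    where four = length≤zeroCount _ unique zeros

  three-zeros-and-one : ∀ x y z w → Unique (x ∷ y ∷ z ∷ []) → All ZeroOf (x ∷ y ∷ z ∷ []) →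
    (s ≢ 0 → All (w ≢_) (x ∷ y ∷ z ∷ []) × ZeroOf w) → Bounds
  three-zeros-and-one _ _ _ w unique zeros extra = length≤zeroCount _ unique zeros , λ s≢0 →
    let (w∉xyz , w-zero) = extra s≢0 in length≤zeroCount (w ∷ _) (w∉xyz ∷ unique) (w-zero ∷ zeros)

  -- j₀ = t + 1 ≡ -1/c gives the zero (1, j₀), and k = p - 1 - j₀ is the column of the zero in row q;
  -- the clauses are j₀ = 1, j₀ = p - 1, j₀ = p - 2 and the generic case.
  bounds-from : ∀ t k → t ℕ.+ k ≡ q → + suc t * + suc m + 1ℤ ≈ 0ℤ → Bounds
  bounds-from zero k refl j₀c+1≈0 =
    three-zeros-and-one (1 , 1) (3 , 3) (5 , 5) (q , q)
      (((λ ()) ∷ (λ ()) ∷ []) ∷ ((λ ()) ∷ []) ∷ [] ∷ [])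
      ((a<1+a+b , a<1+a+b , F-row1-zero (+ m) 1 j₀c+1≈0) ∷
       (a<1+a+b , a<1+a+b , proj₁ diagonal) ∷
       (a<1+a+b , a<1+a+b , proj₂ diagonal) ∷ [])
      (λ s≢0 → ((λ ()) ∷ (λ ()) ∷ s≢0 ∘ ℕ.+-cancelˡ-≡ 5 s 0 ∘ ,-injectiveˡ ∷ []) ,
               (q<p , q<p , F-row[p-2]-zero (+ m) 0 (4 ℕ.+ s) refl j₀c+1≈0))
    where
    diagonal : F (+ m) 3 3 ≈ 0ℤ × F (+ m) 5 5 ≈ 0ℤ
    diagonal = F-diagonal-zeros (+ m) (≈-trans (≈-reflexive (cong (_+ 1ℤ) (sym (ℤ.*-identityˡ (+ suc m))))) j₀c+1≈0)
  bounds-from t zero t+0≡q j₀c+1≈0 with trans (sym (ℕ.+-identityʳ t)) t+0≡q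
  ... | refl = four-zeros (1 , suc q) (suc q , 1) (q , 2) (2 , q)
      (((λ ()) ∷ (λ ()) ∷ (λ ()) ∷ []) ∷ ((λ ()) ∷ (λ ()) ∷ []) ∷ ((λ ()) ∷ []) ∷ [] ∷ [])
      (row1 ∷ transpose row1 ∷ row[p-2] ∷ transpose row[p-2] ∷ [])
    where
    row1 : ZeroOf (1 , suc q)
    row1 = a<1+a+b , ℕ.n<1+n (suc q) , F-row1-zero (+ m) (suc q) j₀c+1≈0
    row[p-2] : ZeroOf (q , 2)
    row[p-2] = q<p , a<1+a+b , F-row[p-2]-zero-at-2 (s≤s (s≤s z≤n)) (+ m) j₀c+1≈0
  bounds-from t (suc zero) t+1≡q j₀c+1≈0 with trans (ℕ.+-comm 1 t) t+1≡q
  ... | refl = three-zeros-and-one (1 , q) (q , 1) (3 , 3 ℕ.+ s) (3 ℕ.+ s , 3)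
      (((λ ()) ∷ (λ ()) ∷ []) ∷ ((λ ()) ∷ []) ∷ [] ∷ [])
      (row1 ∷ transpose row1 ∷ row3 ∷ [])
      (λ s≢0 → ((λ ()) ∷ (λ ()) ∷ s≢0 ∘ ℕ.+-cancelˡ-≡ 3 s 0 ∘ ,-injectiveˡ ∷ []) , transpose row3)
    where
    c = + suc m
    row1 : ZeroOf (1 , q)
    row1 = a<1+a+b , q<p , F-row1-zero (+ m) q j₀c+1≈0
    identity : ∀ q c → + 2 * c ≡ (1ℤ + -1ℤ * (q * c + 1ℤ)) + c * (+ 2 + q)
    identity = solve-∀
    2c≈1 : + 2 * c ≈ 1ℤ
    2c≈1 = ≈-trans (≈-by-multiple c (identity (+ q) c)) (+-cong (≈-refl {1ℤ}) (*-cong (≈-refl { -1ℤ}) j₀c+1≈0))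
    row3 : ZeroOf (3 , 3 ℕ.+ s)
    row3 = a<1+a+b , ℕ.+-monoˡ-< s (a<1+a+b {3} {3}) , F-row3-zero p-prime a<1+a+b (+ m) (3 ℕ.+ s) 2c≈1 n≈0
  bounds-from (suc t) (suc (suc k)) eq j₀c+1≈0 =
    four-zeros (1 , j₀) (j₀ , 1) (q , col) (col , q)
      (((λ ()) ∷ (λ ()) ∷ (λ ()) ∷ []) ∷ ((λ ()) ∷ (λ ()) ∷ []) ∷
       ((ℕ.<⇒≢ col<q ∘ sym ∘ ,-injectiveˡ) ∷ []) ∷ [] ∷ [])
      (row1 ∷ transpose row1 ∷ row[p-2] ∷ transpose row[p-2] ∷ [])
    where
    j₀ = suc (suc t)
    col = suc (suc k)
    col<q : col < q
    col<q = subst (col <_) eq (ℕ.m<n+m col (s≤s z≤n))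
    row1 : ZeroOf (1 , j₀)
    row1 = a<1+a+b , s≤s (s≤s (subst (suc t ≤_) eq (ℕ.m≤m+n (suc t) col))) , F-row1-zero (+ m) j₀ j₀c+1≈0
    row[p-2] : ZeroOf (q , col)
    row[p-2] = q<p , ℕ.<-trans col<q q<p , F-row[p-2]-zero (+ m) (suc t) (suc k) eq j₀c+1≈0

  bounds : suc m < p → Bounds
  bounds 1+m<p = from-inverse (negated-inverse p-prime m 1+m<p)
    where
    from-inverse : ∃[ j₀ ] (j₀ < p × + j₀ * + suc m + 1ℤ ≈ 0ℤ) → Bounds
    from-inverse (zero  , _               , 1≈0)     = contradiction (ℕ∣1⇒≡1 (∣⇒∣ᵤ (≈0⇒∣ 1≈0))) λ ()
    from-inverse (suc t , s≤s (s≤s t≤q) , j₀c+1≈0) = bounds-from t (q ℕ.∸ t) (ℕ.m+[n∸m]≡n t≤q) j₀c+1≈0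

corollary5p5 : (p : ℕ) .{{_ : NonZero p}} → Prime p → (m : ℕ) → m < p → m ≢ p ∸ 1 →
    (p ≡ 7 → zeroCount p m ≥ 3) × (p ≥ 11 → zeroCount p m ≥ 4)
corollary5p5 p p-prime m m<p m≢p-1 =
  (λ { refl → proj₁ (bounds ℕ.≤-refl) }) ,
  λ p≥11 → let 7<p = ℕ.<-≤-trans (ℕ.m≤m+n 8 3) p≥11 in proj₂ (bounds (ℕ.<⇒≤ 7<p)) (ℕ.>⇒≢ 7<p)
  where
  bounds : 7 ≤ p → 3 ≤ zeroCount p m × (p ≢ 7 → 4 ≤ zeroCount p m)
  bounds (s≤s (s≤s (s≤s (s≤s (s≤s (s≤s (s≤s {n = s} z≤n))))))) =
    let three , four = Zeros.bounds s p-prime m (s≤s (ℕ.≤∧≢⇒< (ℕ.≤-pred m<p) m≢p-1)) in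
    three , λ p≢7 → four (p≢7 ∘ cong (7 ℕ.+_))
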